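{- Let $p \geq 5$ be a prime. For $j \in \mathbb{F}_p$ let $f_j(x) = x^2 - 2(j+1)x + (j-1)^2$, and for $k \in \mathbb{F}_p$ let $$\epsilon_k = \sum_{x=0}^{p-1} \left(\frac{f_1(x) f_k(x)}{p}\right).$$ Let $k \in \{1, \ldots, p-1\}$ with $k \not\equiv 1, 9 \pmod p$. Let $g_k(x) = x\big(4kx^2 + (k^2 - 6k - 3)x + 4\big)$, let $E_k$ be the curve $y^2 = g_k(x)$ over $\mathbb{F}_p$ (an elliptic curve), and let $a_p(E_k) = p + 1 - |E_k(\mathbb{F}_p)|$ be its Frobenius trace, where $|E_k(\mathbb{F}_p)|$ counts the points including the point at infinity. Then $$\epsilon_k = -1 - a_p(E_k).$$
   Context: $\left(\frac{a}{p}\right)$ denotes the Legendre symbol modulo $p$, with $\left(\frac{0}{p}\right) = 0$. -}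

module Defs where

open import Data.Nat as ℕ using (ℕ; zero; suc; NonZero)
open import Data.Integer as ℤ using (ℤ; +_; -_; _+_; _-_; _*_; 0ℤ; 1ℤ; -1ℤ)
open import Data.Integer.DivMod using (_%ℕ_)
open import Data.List using (List; upTo; map; filter; length; foldr; cartesianProduct)
open import Data.Product using (proj₁; proj₂)
open import Data.List.Relation.Unary.Any using (any?)
open import Relation.Nullary using (yes; no)
open import Relation.Nullary.Decidable using (⌊_⌋)
open import Data.Bool using (if_then_else_)
open import Data.Nat.Properties using (_≟_)

legendre : (p : ℕ) .{{_ : NonZero p}} → ℤ → ℤ
legendre p a with a %ℕ p ≟ 0
... | yes _ = 0ℤ
... | no _ with any? (λ y → (+ (y ℕ.* y)) %ℕ p ≟ a %ℕ p) (upTo p)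
...   | yes _ = 1ℤ
...   | no _ = -1ℤ

-- f_j(x) = x² - 2(j+1)x + (j-1)²  (as an integer polynomial; reduced mod p by legendre)
f : ℤ → ℤ → ℤ
f j x = x * x - (+ 2) * (j + 1ℤ) * x + (j - 1ℤ) * (j - 1ℤ)

ε : (p : ℕ) .{{_ : NonZero p}} → ℕ → ℤ
ε p k = foldr _+_ 0ℤ (map (λ x → legendre p (f 1ℤ (+ x) * f (+ k) (+ x))) (upTo p))

g : ℤ → ℤ → ℤ
g k x = x * ((+ 4) * k * x * x + (k * k - (+ 6) * k - (+ 3)) * x + (+ 4))

-- |E_k(F_p)| : number of affine solutions (x, y) ∈ F_p² of y² = g_k(x), plus the point at infinity
#E : (p : ℕ) .{{_ : NonZero p}} → ℕ → ℕ
#E p k = suc (length (filter (λ xy → (+ (proj₂ xy ℕ.* proj₂ xy)) %ℕ p ≟ g (+ k) (+ proj₁ xy) %ℕ p)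
                              (cartesianProduct (upTo p) (upTo p))))

aₚ : (p : ℕ) .{{_ : NonZero p}} → ℕ → ℤ
aₚ p k = + (p ℕ.+ 1) - + (#E p k)

{-# OPTIONS --safe #-}
-- Write χ for the Legendre symbol and K = k.  Substituting x = 1/u turns ε into
-- Σ_u χ((1 - 4u)(1 - 2(K+1)u + (K-1)²u²)) - 1: the point x = 0 drops out because f₁(0) = 0,
-- and u = 0 contributes χ(1).  With m = (K-1)², the affine change u = (m - z)/(4m) turns the
-- quartic, up to the square factor (4m)², into the cubic z(z² + Bz + Cm) with
-- B = -2(K² - 6K - 3), C = (K-1)(K-9).  The 2-isogeny identity
-- Σ χ(x(x² + ax + b)) = Σ χ(s(s² - 2as + a² - 4b))   (b ≢ 0)
-- holds because x ↦ x + b/x hits t exactly 1 + χ(t² - 4b) times, and the scaling s = 16Kx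
-- turns its right-hand side into Σ χ(g_K(x)).  Finally y² = D has 1 + χ(D) solutions, so
-- |E_K(F_p)| = 1 + p + Σ χ(g_K(x)) and a_p(E_K) = -Σ χ(g_K(x)).
module Submission where

open import Defs
open import Data.Nat using (ℕ; _≤_; _<_; _%_; NonZero)
open import Data.Nat.Primality using (Prime)
open import Data.Integer using (ℤ; _-_; -1ℤ)
open import Relation.Binary.PropositionalEquality using (_≡_; _≢_)

import Data.Nat as ℕ
import Data.Nat.Properties as ℕ
import Data.Nat.DivMod as ℕ
import Data.Nat.Divisibility as ℕ
open import Data.Nat.Primality using (euclidsLemma; prime⇒nonTrivial)
open import Data.Nat.Coprimality using (coprime-Bézout; prime⇒coprime)
open import Data.Nat.GCD using (module Bézout)
open import Data.Integer as ℤ using (+_; -_; _+_; _*_; 0ℤ; 1ℤ; ∣_∣)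
import Data.Integer.Properties as ℤ
open import Data.Integer.Divisibility.Signed using (_∣_; divides; ∣⇒∣ᵤ; ∣ᵤ⇒∣; ∣n⇒∣m*n; ∣m∣n⇒∣m+n)
open import Data.Integer.DivMod using (_%ℕ_; _/ℕ_; a≡a%ℕn+[a/ℕn]*n; n%ℕd<d)
open import Data.Integer.Tactic.RingSolver using (solve-∀)
open import Data.List using (List; []; _∷_; _++_; [_]; upTo; map; foldr; filter; length; cartesianProduct)
import Data.List.Properties as List
open import Data.List.Relation.Unary.Any using (here; there; any?; satisfied)
open import Data.List.Membership.Propositional using (_∈_; lose)
open import Data.List.Membership.Propositional.Properties using (∈-upTo⁺)
open import Data.Product using (Σ; _×_; _,_; proj₁; proj₂)
open import Data.Sum using (_⊎_; inj₁; inj₂; [_,_]′)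
open import Function using (_∘_)
open import Level using (0ℓ)
open import Relation.Nullary using (¬_; Dec; yes; no; contradiction)
open import Relation.Unary using (Pred; Decidable)
open import Relation.Binary.Bundles using (Setoid)
open import Relation.Binary.Core using (_Preserves_⟶_)
import Relation.Binary.Reasoning.Setoid as SetoidReasoning
open import Relation.Binary.PropositionalEquality using (refl; sym; trans; cong; cong₂; subst; module ≡-Reasoning)

private variable
  A A′ : Set

nonpos-+-≡0 : ∀ {a b} → a ℤ.≤ 0ℤ → b ℤ.≤ 0ℤ → a + b ≡ 0ℤ → a ≡ 0ℤ
nonpos-+-≡0 {a} {b} a≤0 b≤0 a+b≡0 = ℤ.≤-antisym a≤0 (begin
  0ℤ     ≡⟨ sym a+b≡0 ⟩
  a + b  ≤⟨ ℤ.+-monoʳ-≤ a b≤0 ⟩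
  a + 0ℤ ≡⟨ ℤ.+-identityʳ a ⟩
  a      ∎)
  where open ℤ.≤-Reasoning

sumOver : List A → (A → ℤ) → ℤ
sumOver xs F = foldr _+_ 0ℤ (map F xs)

sumOver-cong : ∀ (xs : List A) {F G : A → ℤ} → (∀ x → F x ≡ G x) → sumOver xs F ≡ sumOver xs G
sumOver-cong []       F≗G = refl
sumOver-cong (x ∷ xs) F≗G = cong₂ _+_ (F≗G x) (sumOver-cong xs F≗G)

sumOver-++ : ∀ (xs ys : List A) F → sumOver (xs ++ ys) F ≡ sumOver xs F + sumOver ys F
sumOver-++ []       ys F = sym (ℤ.+-identityˡ _)
sumOver-++ (x ∷ xs) ys F = trans (cong (_+_ (F x)) (sumOver-++ xs ys F)) (sym (ℤ.+-assoc (F x) _ _))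

sumOver-+ : ∀ (xs : List A) F G → sumOver xs (λ x → F x + G x) ≡ sumOver xs F + sumOver xs G
sumOver-+ []       F G = refl
sumOver-+ (x ∷ xs) F G = trans (cong (_+_ (F x + G x)) (sumOver-+ xs F G)) (interchange (F x) (G x) _ _)
  where
  interchange : ∀ a b c d → (a + b) + (c + d) ≡ (a + c) + (b + d)
  interchange = solve-∀

sumOver-*ˡ : ∀ (xs : List A) c F → sumOver xs (λ x → c * F x) ≡ c * sumOver xs F
sumOver-*ˡ []       c F = sym (ℤ.*-zeroʳ c)
sumOver-*ˡ (x ∷ xs) c F = trans (cong (_+_ (c * F x)) (sumOver-*ˡ xs c F)) (sym (ℤ.*-distribˡ-+ c (F x) _))

sumOver-zero : ∀ (xs : List A) → sumOver xs (λ _ → 0ℤ) ≡ 0ℤ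
sumOver-zero []       = refl
sumOver-zero (x ∷ xs) = trans (ℤ.+-identityˡ _) (sumOver-zero xs)

sumOver-one : ∀ (xs : List A) → sumOver xs (λ _ → 1ℤ) ≡ + length xs
sumOver-one []       = refl
sumOver-one (x ∷ xs) = trans (cong (_+_ 1ℤ) (sumOver-one xs)) (sym (ℤ.pos-+ 1 (length xs)))

sumOver-comm : ∀ (xs : List A) (ys : List A′) (F : A → A′ → ℤ) →
               sumOver xs (λ x → sumOver ys (F x)) ≡ sumOver ys (λ y → sumOver xs (λ x → F x y))
sumOver-comm []       ys F = sym (sumOver-zero ys)
sumOver-comm (x ∷ xs) ys F =
  trans (cong (_+_ (sumOver ys (F x))) (sumOver-comm xs ys F)) (sym (sumOver-+ ys (F x) _))

sumOver-nonpos : ∀ (xs : List A) {F} → (∀ x → F x ℤ.≤ 0ℤ) → sumOver xs F ℤ.≤ 0ℤ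
sumOver-nonpos []       F≤0 = ℤ.≤-refl
sumOver-nonpos (x ∷ xs) F≤0 = ℤ.+-mono-≤ (F≤0 x) (sumOver-nonpos xs F≤0)

sumOver-nonpos-≡0 : ∀ {xs : List A} {F} → (∀ x → F x ℤ.≤ 0ℤ) → sumOver xs F ≡ 0ℤ → ∀ {x} → x ∈ xs → F x ≡ 0ℤ
sumOver-nonpos-≡0 {xs = x ∷ xs} {F} F≤0 sum≡0 (here refl) =
  nonpos-+-≡0 (F≤0 x) (sumOver-nonpos xs F≤0) sum≡0
sumOver-nonpos-≡0 {xs = x ∷ xs} {F} F≤0 sum≡0 (there y∈xs) =
  sumOver-nonpos-≡0 F≤0 (nonpos-+-≡0 (sumOver-nonpos xs F≤0) (F≤0 x) (trans (ℤ.+-comm _ (F x)) sum≡0)) y∈xs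

sumOver-map : ∀ (g : A → A′) xs F → sumOver (map g xs) F ≡ sumOver xs (F ∘ g)
sumOver-map g xs F = cong (foldr _+_ 0ℤ) (sym (List.map-∘ xs))

sumOver-cartesianProduct : ∀ (xs : List A) (ys : List A′) F →
  sumOver (cartesianProduct xs ys) F ≡ sumOver xs (λ x → sumOver ys (λ y → F (x , y)))
sumOver-cartesianProduct []       ys F = refl
sumOver-cartesianProduct (x ∷ xs) ys F = trans (sumOver-++ (map (x ,_) ys) _ F)
  (cong₂ _+_ (sumOver-map (x ,_) ys F) (sumOver-cartesianProduct xs ys F))

indicator : ∀ {P : Set} → Dec P → ℤ
indicator (yes _) = 1ℤ
indicator (no _)  = 0ℤ

indicator-yes : ∀ {P : Set} → P → (P? : Dec P) → indicator P? ≡ 1ℤ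
indicator-yes p (yes _) = refl
indicator-yes p (no ¬p) = contradiction p ¬p

indicator-no : ∀ {P : Set} → ¬ P → (P? : Dec P) → indicator P? ≡ 0ℤ
indicator-no ¬p (yes p) = contradiction p ¬p
indicator-no ¬p (no _)  = refl

indicator-⇔ : ∀ {P Q : Set} → (P → Q) → (Q → P) → (P? : Dec P) (Q? : Dec Q) → indicator P? ≡ indicator Q?
indicator-⇔ P→Q Q→P (yes p) Q? = sym (indicator-yes (P→Q p) Q?)
indicator-⇔ P→Q Q→P (no ¬p) Q? = sym (indicator-no (¬p ∘ Q→P) Q?)

length-filter : ∀ {P : Pred A 0ℓ} (P? : Decidable P) xs →
                + length (filter P? xs) ≡ sumOver xs (indicator ∘ P?)
length-filter P? []       = refl
length-filter P? (x ∷ xs) with P? x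
... | yes _ = cong (_+_ 1ℤ) (length-filter P? xs)
... | no  _ = trans (length-filter P? xs) (sym (ℤ.+-identityˡ _))

sumOver-upTo-suc : ∀ n F → sumOver (upTo (ℕ.suc n)) F ≡ sumOver (upTo n) F + F n
sumOver-upTo-suc n F = begin
  sumOver (upTo (ℕ.suc n)) F         ≡⟨ cong (λ xs → sumOver xs F) (sym (List.upTo-∷ʳ n)) ⟩
  sumOver (upTo n ++ [ n ]) F        ≡⟨ sumOver-++ (upTo n) [ n ] F ⟩
  sumOver (upTo n) F + (F n + 0ℤ)    ≡⟨ cong (_+_ (sumOver (upTo n) F)) (ℤ.+-identityʳ (F n)) ⟩
  sumOver (upTo n) F + F n           ∎
  where open ≡-Reasoning

sumOver-upTo-vanish : ∀ n H → (∀ t → t < n → H t ≡ 0ℤ) → sumOver (upTo n) H ≡ 0ℤ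
sumOver-upTo-vanish ℕ.zero    H H≡0 = refl
sumOver-upTo-vanish (ℕ.suc n) H H≡0 = trans (sumOver-upTo-suc n H)
  (cong₂ _+_ (sumOver-upTo-vanish n H (λ t t<n → H≡0 t (ℕ.m<n⇒m<1+n t<n))) (H≡0 n ℕ.≤-refl))

sumOver-upTo-single : ∀ n r H → r < n → (∀ t → t < n → t ≢ r → H t ≡ 0ℤ) → sumOver (upTo n) H ≡ H r
sumOver-upTo-single (ℕ.suc n) r H r<1+n H≡0 with r ℕ.≟ n
... | yes refl = trans (sumOver-upTo-suc n H)
  (trans (cong (_+ H r) (sumOver-upTo-vanish n H (λ t t<n → H≡0 t (ℕ.m<n⇒m<1+n t<n) (ℕ.<⇒≢ t<n))))
         (ℤ.+-identityˡ (H r)))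
... | no r≢n = trans (sumOver-upTo-suc n H)
  (trans (cong₂ _+_ (sumOver-upTo-single n r H (ℕ.≤∧≢⇒< (ℕ.≤-pred r<1+n) r≢n) (λ t t<n → H≡0 t (ℕ.m<n⇒m<1+n t<n)))
                    (H≡0 n ℕ.≤-refl (r≢n ∘ sym)))
         (ℤ.+-identityʳ (H r)))

module Congruence (p : ℕ) .{{_ : NonZero p}} where

  infix 4 _≈_ _≈?_

  record _≈_ (a b : ℤ) : Set where
    constructor mk≈
    field p∣a-b : + p ∣ a - b

  ≈-reflexive : ∀ {a b} → a ≡ b → a ≈ b
  ≈-reflexive {a} refl = mk≈ (divides 0ℤ (ℤ.+-inverseʳ a))

  ≈-refl : ∀ {a} → a ≈ a
  ≈-refl = ≈-reflexive refl

  ≈-by : ∀ {a b c d} k → a - b ≡ k * (c - d) → c ≈ d → a ≈ b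
  ≈-by k eq (mk≈ p∣c-d) = mk≈ (subst (+ p ∣_) (sym eq) (∣n⇒∣m*n k p∣c-d))

  ≈-by₂ : ∀ {a b c d e f} k l → a - b ≡ k * (c - d) + l * (e - f) → c ≈ d → e ≈ f → a ≈ b
  ≈-by₂ k l eq (mk≈ p∣c-d) (mk≈ p∣e-f) =
    mk≈ (subst (+ p ∣_) (sym eq) (∣m∣n⇒∣m+n (∣n⇒∣m*n k p∣c-d) (∣n⇒∣m*n l p∣e-f)))

  ≈-sym : ∀ {a b} → a ≈ b → b ≈ a
  ≈-sym {a} {b} = ≈-by (- 1ℤ) (eq a b)
    where
    eq : ∀ a b → b - a ≡ - 1ℤ * (a - b)
    eq = solve-∀

  ≈-trans : ∀ {a b c} → a ≈ b → b ≈ c → a ≈ c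
  ≈-trans {a} {b} {c} = ≈-by₂ 1ℤ 1ℤ (eq a b c)
    where
    eq : ∀ a b c → a - c ≡ 1ℤ * (a - b) + 1ℤ * (b - c)
    eq = solve-∀

  +-cong : ∀ {a b c d} → a ≈ b → c ≈ d → a + c ≈ b + d
  +-cong {a} {b} {c} {d} = ≈-by₂ 1ℤ 1ℤ (eq a b c d)
    where
    eq : ∀ a b c d → (a + c) - (b + d) ≡ 1ℤ * (a - b) + 1ℤ * (c - d)
    eq = solve-∀

  *-cong : ∀ {a b c d} → a ≈ b → c ≈ d → a * c ≈ b * d
  *-cong {a} {b} {c} {d} = ≈-by₂ c b (eq a b c d)
    where
    eq : ∀ a b c d → a * c - b * d ≡ c * (a - b) + b * (c - d)
    eq = solve-∀

  neg-cong : ∀ {a b} → a ≈ b → - a ≈ - b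
  neg-cong {a} {b} = ≈-by (- 1ℤ) (eq a b)
    where
    eq : ∀ a b → - a - - b ≡ - 1ℤ * (a - b)
    eq = solve-∀

  -‿cong : ∀ {a b c d} → a ≈ b → c ≈ d → a - c ≈ b - d
  -‿cong a≈b c≈d = +-cong a≈b (neg-cong c≈d)

  ≈-setoid : Setoid 0ℓ 0ℓ
  ≈-setoid = record
    { Carrier       = ℤ
    ; _≈_           = _≈_
    ; isEquivalence = record { refl = ≈-refl ; sym = ≈-sym ; trans = ≈-trans }
    }

  module ≈-Reasoning = SetoidReasoning ≈-setoid

  -≈0⇒≈ : ∀ {a b} → a - b ≈ 0ℤ → a ≈ b
  -≈0⇒≈ {a} {b} = ≈-by 1ℤ (eq a b)
    where
    eq : ∀ a b → a - b ≡ 1ℤ * ((a - b) - 0ℤ)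
    eq = solve-∀

  +≈0⇒≈- : ∀ {a b} → a + b ≈ 0ℤ → a ≈ - b
  +≈0⇒≈- {a} {b} = ≈-by 1ℤ (eq a b)
    where
    eq : ∀ a b → a - - b ≡ 1ℤ * ((a + b) - 0ℤ)
    eq = solve-∀

  %ℕ-≈ : ∀ a → + (a %ℕ p) ≈ a
  %ℕ-≈ a = mk≈ (divides (- (a /ℕ p)) (begin
    + (a %ℕ p) - a                              ≡⟨ cong (_-_ (+ (a %ℕ p))) (a≡a%ℕn+[a/ℕn]*n a p) ⟩
    + (a %ℕ p) - (+ (a %ℕ p) + a /ℕ p * + p)    ≡⟨ eq (+ (a %ℕ p)) (a /ℕ p) (+ p) ⟩
    - (a /ℕ p) * + p                            ∎))
    where
    open ≡-Reasoning
    eq : ∀ r q P → r - (r + q * P) ≡ - q * P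
    eq = solve-∀

  residue-≡ : ∀ {r s} → r ℕ.≤ s → s < p → + r ≈ + s → r ≡ s
  residue-≡ {r} {s} r≤s s<p (mk≈ p∣r-s) = ℕ.≤-antisym r≤s (ℕ.m∸n≡0⇒m≤n s∸r≡0)
    where
    p∣s∸r : p ℕ.∣ s ℕ.∸ r
    p∣s∸r = subst (p ℕ.∣_) (trans (cong ∣_∣ (ℤ.[+m]-[+n]≡m⊖n r s)) (ℤ.∣⊖∣-≤ r≤s)) (∣⇒∣ᵤ p∣r-s)
    s∸r≡0 : s ℕ.∸ r ≡ 0
    s∸r≡0 = trans (sym (ℕ.m<n⇒m%n≡m (ℕ.≤-<-trans (ℕ.m∸n≤m s r) s<p))) (ℕ.n∣m⇒m%n≡0 _ p p∣s∸r)

  ≈⇒%ℕ≡ : ∀ {a b} → a ≈ b → a %ℕ p ≡ b %ℕ p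
  ≈⇒%ℕ≡ {a} {b} a≈b with ℕ.≤-total (a %ℕ p) (b %ℕ p)
  ... | inj₁ r≤s = residue-≡ r≤s (n%ℕd<d b p) (≈-trans (%ℕ-≈ a) (≈-trans a≈b (≈-sym (%ℕ-≈ b))))
  ... | inj₂ s≤r = sym (residue-≡ s≤r (n%ℕd<d a p) (≈-trans (%ℕ-≈ b) (≈-trans (≈-sym a≈b) (≈-sym (%ℕ-≈ a)))))

  %ℕ≡⇒≈ : ∀ {a b} → a %ℕ p ≡ b %ℕ p → a ≈ b
  %ℕ≡⇒≈ {a} {b} eq = ≈-trans (≈-sym (%ℕ-≈ a)) (≈-trans (≈-reflexive (cong +_ eq)) (%ℕ-≈ b))

  ≈0⇒%ℕ≡0 : ∀ {a} → a ≈ 0ℤ → a %ℕ p ≡ 0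
  ≈0⇒%ℕ≡0 {a} a≈0 = sym (residue-≡ ℕ.z≤n (n%ℕd<d a p) (≈-sym (≈-trans (%ℕ-≈ a) a≈0)))

  _≈?_ : ∀ a b → Dec (a ≈ b)
  a ≈? b with a %ℕ p ℕ.≟ b %ℕ p
  ... | yes eq = yes (%ℕ≡⇒≈ eq)
  ... | no  ne = no (ne ∘ ≈⇒%ℕ≡)

  +-≉0 : ∀ {n} → 0 < n → n < p → ¬ (+ n ≈ 0ℤ)
  +-≉0 {n} 0<n n<p n≈0 = ℕ.<⇒≢ 0<n (residue-≡ ℕ.z≤n n<p (≈-sym n≈0))

module PrimeField (p : ℕ) .{{_ : NonZero p}} (p-prime : Prime p) where

  open Congruence p public

  private
    ≈0⇒∣ : ∀ {a} → a ≈ 0ℤ → + p ∣ a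
    ≈0⇒∣ {a} (mk≈ p∣a-0) = subst (+ p ∣_) (ℤ.+-identityʳ a) p∣a-0

    ∣⇒≈0 : ∀ {a} → + p ∣ a → a ≈ 0ℤ
    ∣⇒≈0 {a} p∣a = mk≈ (subst (+ p ∣_) (sym (ℤ.+-identityʳ a)) p∣a)

  1≉0 : ¬ (1ℤ ≈ 0ℤ)
  1≉0 = +-≉0 ℕ.z<s (ℕ.nonTrivial⇒n>1 p {{prime⇒nonTrivial p-prime}})

  *-≈0 : ∀ {a b} → a * b ≈ 0ℤ → a ≈ 0ℤ ⊎ b ≈ 0ℤ
  *-≈0 {a} {b} ab≈0 with euclidsLemma ∣ a ∣ ∣ b ∣ p-prime (subst (p ℕ.∣_) (ℤ.abs-* a b) (∣⇒∣ᵤ (≈0⇒∣ ab≈0)))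
  ... | inj₁ p∣a = inj₁ (∣⇒≈0 (∣ᵤ⇒∣ p∣a))
  ... | inj₂ p∣b = inj₂ (∣⇒≈0 (∣ᵤ⇒∣ p∣b))

  *-cancelˡ-≈0 : ∀ {a b} → ¬ (a ≈ 0ℤ) → a * b ≈ 0ℤ → b ≈ 0ℤ
  *-cancelˡ-≈0 a≉0 ab≈0 = [ (λ a≈0 → contradiction a≈0 a≉0) , (λ b≈0 → b≈0) ]′ (*-≈0 ab≈0)

  *-≉0 : ∀ {a b} → ¬ (a ≈ 0ℤ) → ¬ (b ≈ 0ℤ) → ¬ (a * b ≈ 0ℤ)
  *-≉0 a≉0 b≉0 = b≉0 ∘ *-cancelˡ-≈0 a≉0

  private
    residue-inverse : ∀ {r} → 0 < r → r < p → Σ ℤ λ b → + r * b ≈ 1ℤ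
    residue-inverse {r@(ℕ.suc _)} _ r<p with coprime-Bézout (prime⇒coprime p-prime r<p)
    ... | Bézout.+- x y eq = - + y , mk≈ (divides (- + x) (begin
      + r * - + y - 1ℤ    ≡⟨ eq₁ (+ r) (+ y) ⟩
      - (1ℤ + + y * + r)  ≡⟨ cong -_ (cast eq) ⟩
      - (+ x * + p)       ≡⟨ ℤ.neg-distribˡ-* (+ x) (+ p) ⟩
      - + x * + p         ∎))
      where
      open ≡-Reasoning
      eq₁ : ∀ r y → r * - y - 1ℤ ≡ - (1ℤ + y * r)
      eq₁ = solve-∀
      cast : 1 ℕ.+ y ℕ.* r ≡ x ℕ.* p → 1ℤ + + y * + r ≡ + x * + p
      cast e = trans (cong (_+_ 1ℤ) (sym (ℤ.pos-* y r)))
                     (trans (sym (ℤ.pos-+ 1 (y ℕ.* r))) (trans (cong +_ e) (ℤ.pos-* x p)))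
    ... | Bézout.-+ x y eq = + y , mk≈ (divides (+ x) (begin
      + r * + y - 1ℤ        ≡⟨ cong (_- 1ℤ) (trans (ℤ.*-comm (+ r) (+ y)) (sym (ℤ.pos-* y r))) ⟩
      + (y ℕ.* r) - 1ℤ      ≡⟨ cong (_- 1ℤ) (cong +_ (sym eq)) ⟩
      + (1 ℕ.+ x ℕ.* p) - 1ℤ ≡⟨ cong (_- 1ℤ) (trans (ℤ.pos-+ 1 (x ℕ.* p)) (cong (_+_ 1ℤ) (ℤ.pos-* x p))) ⟩
      1ℤ + + x * + p - 1ℤ   ≡⟨ eq₂ (+ x * + p) ⟩
      + x * + p             ∎))
      where
      open ≡-Reasoning
      eq₂ : ∀ z → 1ℤ + z - 1ℤ ≡ z
      eq₂ = solve-∀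

    inverse : ∀ {a} → ¬ (a ≈ 0ℤ) → Σ ℤ λ b → a * b ≈ 1ℤ
    inverse {a} a≉0 with residue-inverse (ℕ.n≢0⇒n>0 r≢0) (n%ℕd<d a p)
      where
      r≢0 : a %ℕ p ≢ 0
      r≢0 r≡0 = a≉0 (≈-trans (≈-sym (%ℕ-≈ a)) (≈-reflexive (cong +_ r≡0)))
    ... | b , rb≈1 = b , ≈-trans (*-cong (≈-sym (%ℕ-≈ a)) ≈-refl) rb≈1

  infix 9 _⁻¹

  -- Totalised by 0 ⁻¹ = 0, which makes _⁻¹ an involution on all residues.
  opaque
    _⁻¹ : ℤ → ℤ
    a ⁻¹ with a ≈? 0ℤ
    ... | yes _   = 0ℤ
    ... | no  a≉0 = proj₁ (inverse a≉0)

    ⁻¹-inverseʳ : ∀ {a} → ¬ (a ≈ 0ℤ) → a * a ⁻¹ ≈ 1ℤ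
    ⁻¹-inverseʳ {a} a≉0 with a ≈? 0ℤ
    ... | yes a≈0  = contradiction a≈0 a≉0
    ... | no  a≉0′ = proj₂ (inverse a≉0′)

    ⁻¹-zero : ∀ {a} → a ≈ 0ℤ → a ⁻¹ ≡ 0ℤ
    ⁻¹-zero {a} a≈0 with a ≈? 0ℤ
    ... | yes _   = refl
    ... | no  a≉0 = contradiction a≈0 a≉0

  ⁻¹-unique : ∀ {a b} → a * b ≈ 1ℤ → b ≈ a ⁻¹
  ⁻¹-unique {a} {b} ab≈1 = -≈0⇒≈ (*-cancelˡ-≈0 a≉0 (begin
      a * (b - a ⁻¹)       ≡⟨ ℤ.*-distribˡ-+ a b (- a ⁻¹) ⟩
      a * b + a * - a ⁻¹   ≡⟨ cong (_+_ (a * b)) (sym (ℤ.neg-distribʳ-* a (a ⁻¹))) ⟩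
      a * b - a * a ⁻¹     ≈⟨ -‿cong ab≈1 (⁻¹-inverseʳ a≉0) ⟩
      1ℤ - 1ℤ              ≡⟨⟩
      0ℤ                   ∎))
    where
    open ≈-Reasoning
    a≉0 : ¬ (a ≈ 0ℤ)
    a≉0 a≈0 = 1≉0 (≈-trans (≈-sym ab≈1) (≈-trans (*-cong a≈0 ≈-refl) (≈-reflexive (ℤ.*-zeroˡ b))))

  ⁻¹-≉0 : ∀ {a} → ¬ (a ≈ 0ℤ) → ¬ (a ⁻¹ ≈ 0ℤ)
  ⁻¹-≉0 {a} a≉0 a⁻¹≈0 =
    1≉0 (≈-trans (≈-sym (⁻¹-inverseʳ a≉0)) (≈-trans (*-cong (≈-refl {a}) a⁻¹≈0) (≈-reflexive (ℤ.*-zeroʳ a))))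

  ⁻¹-cong : ∀ {a b} → a ≈ b → a ⁻¹ ≈ b ⁻¹
  ⁻¹-cong {a} {b} a≈b with b ≈? 0ℤ
  ... | yes b≈0 = ≈-reflexive (trans (⁻¹-zero (≈-trans a≈b b≈0)) (sym (⁻¹-zero b≈0)))
  ... | no  b≉0 = ⁻¹-unique (≈-trans (*-cong (≈-sym a≈b) ≈-refl) (⁻¹-inverseʳ (b≉0 ∘ ≈-trans (≈-sym a≈b))))

  ⁻¹-involutive : ∀ a → a ⁻¹ ⁻¹ ≈ a
  ⁻¹-involutive a with a ≈? 0ℤ
  ... | yes a≈0 = ≈-trans (≈-reflexive (⁻¹-zero (≈-reflexive (⁻¹-zero a≈0)))) (≈-sym a≈0)
  ... | no  a≉0 = ≈-sym (⁻¹-unique (≈-trans (≈-reflexive (ℤ.*-comm (a ⁻¹) a)) (⁻¹-inverseʳ a≉0)))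

module ResidueSums (p : ℕ) .{{_ : NonZero p}} where

  open Congruence p

  ∑ : (ℤ → ℤ) → ℤ
  ∑ F = sumOver (upTo p) (F ∘ +_)

  ∑-cong : ∀ {F G} → (∀ x → F x ≡ G x) → ∑ F ≡ ∑ G
  ∑-cong F≗G = sumOver-cong (upTo p) (F≗G ∘ +_)

  ∑-+ : ∀ F G → ∑ (λ x → F x + G x) ≡ ∑ F + ∑ G
  ∑-+ F G = sumOver-+ (upTo p) (F ∘ +_) (G ∘ +_)

  ∑-*ˡ : ∀ c F → ∑ (λ x → c * F x) ≡ c * ∑ F
  ∑-*ˡ c F = sumOver-*ˡ (upTo p) c (F ∘ +_)

  ∑-comm : ∀ (F : ℤ → ℤ → ℤ) → ∑ (λ x → ∑ (F x)) ≡ ∑ (λ y → ∑ (λ x → F x y))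
  ∑-comm F = sumOver-comm (upTo p) (upTo p) (λ x y → F (+ x) (+ y))

  ∑-neg : ∀ F → ∑ (λ x → - F x) ≡ - ∑ F
  ∑-neg F = trans (∑-cong (λ x → sym (ℤ.-1*i≡-i (F x)))) (trans (∑-*ˡ -1ℤ F) (ℤ.-1*i≡-i (∑ F)))

  ∑-one : ∑ (λ _ → 1ℤ) ≡ + p
  ∑-one = trans (sumOver-one (upTo p)) (cong +_ (List.length-upTo p))

  δ : ℤ → ℤ → ℤ
  δ a b = indicator (a ≈? b)

  δ-≈ : ∀ {a b} → a ≈ b → δ a b ≡ 1ℤ
  δ-≈ {a} {b} a≈b = indicator-yes a≈b (a ≈? b)

  δ-≉ : ∀ {a b} → ¬ (a ≈ b) → δ a b ≡ 0ℤ
  δ-≉ {a} {b} a≉b = indicator-no a≉b (a ≈? b)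

  δ-⇔ : ∀ {a b c d} → (a ≈ b → c ≈ d) → (c ≈ d → a ≈ b) → δ a b ≡ δ c d
  δ-⇔ {a} {b} {c} {d} to from = indicator-⇔ to from (a ≈? b) (c ≈? d)

  δ-sym : ∀ a b → δ a b ≡ δ b a
  δ-sym a b = δ-⇔ ≈-sym ≈-sym

  δ-congˡ : ∀ {a a′} b → a ≈ a′ → δ a b ≡ δ a′ b
  δ-congˡ b a≈a′ = δ-⇔ (≈-trans (≈-sym a≈a′)) (≈-trans a≈a′)

  ∑-δ-* : ∀ z {F} → F Preserves _≈_ ⟶ _≡_ → ∑ (λ t → δ z t * F t) ≡ F z
  ∑-δ-* z {F} F-cong = begin
    ∑ (λ t → δ z t * F t)               ≡⟨ sumOver-upTo-single p r _ (n%ℕd<d z p) off-r ⟩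
    δ z (+ r) * F (+ r)                 ≡⟨ cong (_* F (+ r)) (δ-≈ (≈-sym (%ℕ-≈ z))) ⟩
    1ℤ * F (+ r)                        ≡⟨ ℤ.*-identityˡ (F (+ r)) ⟩
    F (+ r)                             ≡⟨ F-cong (%ℕ-≈ z) ⟩
    F z                                 ∎
    where
    open ≡-Reasoning
    r = z %ℕ p
    off-r : ∀ t → t < p → t ≢ r → δ z (+ t) * F (+ t) ≡ 0ℤ
    off-r t t<p t≢r = trans (cong (_* F (+ t)) (δ-≉ z≉t)) (ℤ.*-zeroˡ (F (+ t)))
      where
      z≉t : ¬ (z ≈ + t)
      z≉t z≈t = t≢r (trans (sym (ℕ.m<n⇒m%n≡m t<p)) (sym (≈⇒%ℕ≡ z≈t)))

  ∑-δ : ∀ z → ∑ (δ z) ≡ 1ℤ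
  ∑-δ z = trans (∑-cong (λ t → sym (ℤ.*-identityʳ (δ z t)))) (∑-δ-* z (λ _ → refl))

  ∑-δ′ : ∀ z → ∑ (λ t → δ t z) ≡ 1ℤ
  ∑-δ′ z = trans (∑-cong (λ t → δ-sym t z)) (∑-δ z)

  ∑-fibres : ∀ (w φ F : ℤ → ℤ) → F Preserves _≈_ ⟶ _≡_ →
             ∑ (λ x → w x * F (φ x)) ≡ ∑ (λ t → ∑ (λ x → w x * δ (φ x) t) * F t)
  ∑-fibres w φ F F-cong = begin
    ∑ (λ x → w x * F (φ x))                        ≡⟨ ∑-cong (λ x → cong (w x *_) (sym (∑-δ-* (φ x) F-cong))) ⟩
    ∑ (λ x → w x * ∑ (λ t → δ (φ x) t * F t))      ≡⟨ ∑-cong (λ x → sym (∑-*ˡ (w x) (λ t → δ (φ x) t * F t))) ⟩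
    ∑ (λ x → ∑ (λ t → w x * (δ (φ x) t * F t)))    ≡⟨ ∑-comm (λ x t → w x * (δ (φ x) t * F t)) ⟩
    ∑ (λ t → ∑ (λ x → w x * (δ (φ x) t * F t)))    ≡⟨ ∑-cong (λ t → ∑-cong (λ x → sym (ℤ.*-assoc (w x) (δ (φ x) t) (F t)))) ⟩
    ∑ (λ t → ∑ (λ x → w x * δ (φ x) t * F t))      ≡⟨ ∑-cong (λ t → ∑-*ʳ (F t) (λ x → w x * δ (φ x) t)) ⟩
    ∑ (λ t → ∑ (λ x → w x * δ (φ x) t) * F t)      ∎
    where
    open ≡-Reasoning
    ∑-*ʳ : ∀ c G → ∑ (λ x → G x * c) ≡ ∑ G * c
    ∑-*ʳ c G = trans (∑-cong (λ x → ℤ.*-comm (G x) c)) (trans (∑-*ˡ c G) (ℤ.*-comm c (∑ G)))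

  ∑-reindex : ∀ {F} (σ τ : ℤ → ℤ) → F Preserves _≈_ ⟶ _≡_ →
              (∀ {x t} → σ x ≈ t → x ≈ τ t) → (∀ {x t} → x ≈ τ t → σ x ≈ t) → ∑ (F ∘ σ) ≡ ∑ F
  ∑-reindex {F} σ τ F-cong to from = begin
    ∑ (F ∘ σ)                                  ≡⟨ ∑-cong (λ x → sym (ℤ.*-identityˡ (F (σ x)))) ⟩
    ∑ (λ x → 1ℤ * F (σ x))                     ≡⟨ ∑-fibres (λ _ → 1ℤ) σ F F-cong ⟩
    ∑ (λ t → ∑ (λ x → 1ℤ * δ (σ x) t) * F t)   ≡⟨ ∑-cong (λ t → cong (_* F t) (fibre t)) ⟩
    ∑ (λ t → 1ℤ * F t)                         ≡⟨ ∑-cong (λ t → ℤ.*-identityˡ (F t)) ⟩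
    ∑ F                                        ∎
    where
    open ≡-Reasoning
    fibre : ∀ t → ∑ (λ x → 1ℤ * δ (σ x) t) ≡ 1ℤ
    fibre t = trans (∑-cong (λ x → trans (ℤ.*-identityˡ _) (trans (δ-⇔ to from) (δ-sym x (τ t))))) (∑-δ (τ t))

module AffineSums (p : ℕ) .{{_ : NonZero p}} (p-prime : Prime p) where

  open PrimeField p p-prime
  open ResidueSums p

  ∑-affine : ∀ {F} c d → F Preserves _≈_ ⟶ _≡_ → ¬ (c ≈ 0ℤ) → ∑ (λ x → F (c * x + d)) ≡ ∑ F
  ∑-affine {F} c d F-cong c≉0 = ∑-reindex (λ x → c * x + d) (λ t → c ⁻¹ * (t - d)) F-cong to from
    where
    open ≈-Reasoning
    to : ∀ {x t} → c * x + d ≈ t → x ≈ c ⁻¹ * (t - d)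
    to {x} {t} cx+d≈t = begin
      x                           ≡⟨ ℤ.*-identityˡ x ⟨
      1ℤ * x                      ≈⟨ *-cong (≈-sym (≈-trans (≈-reflexive (ℤ.*-comm (c ⁻¹) c)) (⁻¹-inverseʳ c≉0))) ≈-refl ⟩
      c ⁻¹ * c * x                ≡⟨ eq₂ c (c ⁻¹) x d ⟩
      c ⁻¹ * ((c * x + d) - d)    ≈⟨ *-cong (≈-refl {c ⁻¹}) (-‿cong cx+d≈t ≈-refl) ⟩
      c ⁻¹ * (t - d)              ∎
      where
      eq₂ : ∀ c i x d → i * c * x ≡ i * ((c * x + d) - d)
      eq₂ = solve-∀
    from : ∀ {x t} → x ≈ c ⁻¹ * (t - d) → c * x + d ≈ t
    from {x} {t} x≈ = begin
      c * x + d                   ≈⟨ +-cong (*-cong (≈-refl {c}) x≈) ≈-refl ⟩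
      c * (c ⁻¹ * (t - d)) + d    ≡⟨ eq₃ c (c ⁻¹) t d ⟩
      c * c ⁻¹ * (t - d) + d      ≈⟨ +-cong (*-cong (⁻¹-inverseʳ c≉0) ≈-refl) ≈-refl ⟩
      1ℤ * (t - d) + d            ≡⟨ eq₄ t d ⟩
      t                           ∎
      where
      eq₃ : ∀ c i t d → c * (i * (t - d)) + d ≡ c * i * (t - d) + d
      eq₃ = solve-∀
      eq₄ : ∀ t d → 1ℤ * (t - d) + d ≡ t
      eq₄ = solve-∀

  ∑-translate : ∀ {F} d → F Preserves _≈_ ⟶ _≡_ → ∑ (λ x → F (x + d)) ≡ ∑ F
  ∑-translate {F} d F-cong =
    trans (∑-cong (λ x → cong (λ y → F (y + d)) (sym (ℤ.*-identityˡ x)))) (∑-affine 1ℤ d F-cong 1≉0)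

  ∑-scale : ∀ {F} c → F Preserves _≈_ ⟶ _≡_ → ¬ (c ≈ 0ℤ) → ∑ (λ x → F (c * x)) ≡ ∑ F
  ∑-scale {F} c F-cong c≉0 =
    trans (∑-cong (λ x → cong F (sym (ℤ.+-identityʳ (c * x))))) (∑-affine c 0ℤ F-cong c≉0)

module Legendre (p : ℕ) .{{_ : NonZero p}} (p-prime : Prime p) (p>2 : 2 < p) where

  open PrimeField p p-prime
  open ResidueSums p
  open AffineSums p p-prime

  2≉0 : ¬ (+ 2 ≈ 0ℤ)
  2≉0 = +-≉0 ℕ.z<s p>2

  4≉0 : ¬ (+ 4 ≈ 0ℤ)
  4≉0 = *-≉0 2≉0 2≉0

  χ : ℤ → ℤ
  χ = legendre p

  data LegendreView (a : ℤ) : ℤ → Set where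
    zero      : a ≈ 0ℤ → LegendreView a 0ℤ
    square    : ¬ (a ≈ 0ℤ) → ∀ y → y * y ≈ a → LegendreView a 1ℤ
    nonsquare : ¬ (a ≈ 0ℤ) → (∀ y → ¬ (y * y ≈ a)) → LegendreView a -1ℤ

  legendreView : ∀ a → LegendreView a (χ a)
  -- The two `with`s replay those in the definition of `legendre`, so each branch computes.
  legendreView a with a %ℕ p ℕ.≟ 0
  ... | yes r≡0 = zero (≈-trans (≈-sym (%ℕ-≈ a)) (≈-reflexive (cong +_ r≡0)))
  ... | no  r≢0 with any? (λ y → (+ (y ℕ.* y)) %ℕ p ℕ.≟ a %ℕ p) (upTo p)
  ...   | yes root = square (r≢0 ∘ ≈0⇒%ℕ≡0) (+ y) (≈-trans (≈-reflexive (sym (ℤ.pos-* y y))) (%ℕ≡⇒≈ y²≡a))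
    where
    y = proj₁ (satisfied root)
    y²≡a = proj₂ (satisfied root)
  ...   | no ¬root = nonsquare (r≢0 ∘ ≈0⇒%ℕ≡0) λ y y²≈a →
    ¬root (lose (∈-upTo⁺ (n%ℕd<d y p)) (≈⇒%ℕ≡ (begin
      + ((y %ℕ p) ℕ.* (y %ℕ p))      ≡⟨ ℤ.pos-* (y %ℕ p) (y %ℕ p) ⟩
      + (y %ℕ p) * + (y %ℕ p)        ≈⟨ *-cong (%ℕ-≈ y) (%ℕ-≈ y) ⟩
      y * y                          ≈⟨ y²≈a ⟩
      a                              ∎)))
    where open ≈-Reasoning

  χ-≈0 : ∀ {a} → a ≈ 0ℤ → χ a ≡ 0ℤ
  χ-≈0 {a} a≈0 with χ a | legendreView a
  ... | _ | zero _          = refl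
  ... | _ | square a≉0 _ _  = contradiction a≈0 a≉0
  ... | _ | nonsquare a≉0 _ = contradiction a≈0 a≉0

  χ-square : ∀ {a} → ¬ (a ≈ 0ℤ) → ∀ y → y * y ≈ a → χ a ≡ 1ℤ
  χ-square {a} a≉0 y y²≈a with χ a | legendreView a
  ... | _ | zero a≈0        = contradiction a≈0 a≉0
  ... | _ | square _ _ _    = refl
  ... | _ | nonsquare _ ¬□  = contradiction y²≈a (¬□ y)

  χ-nonsquare : ∀ {a} → ¬ (a ≈ 0ℤ) → (∀ y → ¬ (y * y ≈ a)) → χ a ≡ -1ℤ
  χ-nonsquare {a} a≉0 ¬□ with χ a | legendreView a
  ... | _ | zero a≈0        = contradiction a≈0 a≉0
  ... | _ | square _ y y²≈a = contradiction y²≈a (¬□ y)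
  ... | _ | nonsquare _ _   = refl

  χ-cong : χ Preserves _≈_ ⟶ _≡_
  χ-cong {a} {b} a≈b with χ a | legendreView a
  ... | _ | zero a≈0          = sym (χ-≈0 (≈-trans (≈-sym a≈b) a≈0))
  ... | _ | square a≉0 y y²≈a = sym (χ-square (a≉0 ∘ ≈-trans a≈b) y (≈-trans y²≈a a≈b))
  ... | _ | nonsquare a≉0 ¬□  = sym (χ-nonsquare (a≉0 ∘ ≈-trans a≈b) (λ y y²≈b → ¬□ y (≈-trans y²≈b (≈-sym a≈b))))

  χ-*-square : ∀ u b → ¬ (u ≈ 0ℤ) → χ (u * u * b) ≡ χ b
  χ-*-square u b u≉0 with χ b | legendreView b
  ... | _ | zero b≈0 = χ-≈0 (≈-trans (*-cong (≈-refl {u * u}) b≈0) (≈-reflexive (ℤ.*-zeroʳ (u * u))))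
  ... | _ | square b≉0 y y²≈b = χ-square u²b≉0 (u * y)
    (≈-trans (≈-reflexive (eq u y)) (*-cong (≈-refl {u * u}) y²≈b))
    where
    u²b≉0 = *-≉0 (*-≉0 u≉0 u≉0) b≉0
    eq : ∀ u y → u * y * (u * y) ≡ u * u * (y * y)
    eq = solve-∀
  ... | _ | nonsquare b≉0 ¬□ = χ-nonsquare (*-≉0 (*-≉0 u≉0 u≉0) b≉0) λ z z²≈u²b → ¬□ (z * u ⁻¹) (begin
      z * u ⁻¹ * (z * u ⁻¹)            ≡⟨ eq₁ z (u ⁻¹) ⟩
      z * z * (u ⁻¹ * u ⁻¹)            ≈⟨ *-cong z²≈u²b (≈-refl {u ⁻¹ * u ⁻¹}) ⟩
      u * u * b * (u ⁻¹ * u ⁻¹)        ≡⟨ eq₂ u (u ⁻¹) b ⟩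
      u * u ⁻¹ * (u * u ⁻¹) * b        ≈⟨ *-cong (*-cong (⁻¹-inverseʳ u≉0) (⁻¹-inverseʳ u≉0)) (≈-refl {b}) ⟩
      1ℤ * 1ℤ * b                      ≡⟨ ℤ.*-identityˡ b ⟩
      b                                ∎)
    where
    open ≈-Reasoning
    eq₁ : ∀ z v → z * v * (z * v) ≡ z * z * (v * v)
    eq₁ = solve-∀
    eq₂ : ∀ u v b → u * u * b * (v * v) ≡ u * v * (u * v) * b
    eq₂ = solve-∀

  square-roots : ∀ {D y₀} → ¬ (y₀ ≈ 0ℤ) → y₀ * y₀ ≈ D → ∀ y → δ (y * y) D ≡ δ y y₀ + δ y (- y₀)
  square-roots {D} {y₀} y₀≉0 y₀²≈D y with y ≈? y₀ | y ≈? - y₀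
  ... | yes y≈y₀ | yes y≈-y₀ = contradiction (2y₀≈0 y≈y₀ y≈-y₀) (*-≉0 2≉0 y₀≉0)
    where
    2y₀≈0 : y ≈ y₀ → y ≈ - y₀ → + 2 * y₀ ≈ 0ℤ
    2y₀≈0 y≈y₀ y≈-y₀ = ≈-by₂ (- 1ℤ) 1ℤ (eq y y₀) y≈y₀ y≈-y₀
      where
      eq : ∀ y y₀ → + 2 * y₀ - 0ℤ ≡ - 1ℤ * (y - y₀) + 1ℤ * (y - - y₀)
      eq = solve-∀
  ... | yes y≈y₀ | no _   = δ-≈ (≈-trans (*-cong y≈y₀ y≈y₀) y₀²≈D)
  ... | no _ | yes y≈-y₀ = δ-≈ (≈-trans (*-cong y≈-y₀ y≈-y₀) (≈-trans (≈-reflexive (eq y₀)) y₀²≈D))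
    where
    eq : ∀ y₀ → - y₀ * - y₀ ≡ y₀ * y₀
    eq = solve-∀
  ... | no y≉y₀ | no y≉-y₀ = δ-≉ λ y²≈D →
    [ y≉y₀ ∘ -≈0⇒≈ , y≉-y₀ ∘ +≈0⇒≈- ]′ (*-≈0 (≈-by₂ 1ℤ (- 1ℤ) (eq y y₀ D) y²≈D y₀²≈D))
    where
    eq : ∀ y y₀ D → (y - y₀) * (y + y₀) - 0ℤ ≡ 1ℤ * (y * y - D) + - 1ℤ * (y₀ * y₀ - D)
    eq = solve-∀

  ∑-δ-square : ∀ D → ∑ (λ y → δ (y * y) D) ≡ 1ℤ + χ D
  ∑-δ-square D with χ D | legendreView D
  ... | _ | zero D≈0 = trans (∑-cong (λ y → δ-⇔ (to y) (from y))) (∑-δ′ 0ℤ)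
    where
    to : ∀ y → y * y ≈ D → y ≈ 0ℤ
    to y y²≈D = [ (λ y≈0 → y≈0) , (λ y≈0 → y≈0) ]′ (*-≈0 (≈-trans y²≈D D≈0))
    from : ∀ y → y ≈ 0ℤ → y * y ≈ D
    from y y≈0 = ≈-trans (*-cong y≈0 y≈0) (≈-sym D≈0)
  ... | _ | square D≉0 y₀ y₀²≈D =
    trans (∑-cong (square-roots y₀≉0 y₀²≈D))
          (trans (∑-+ (λ y → δ y y₀) (λ y → δ y (- y₀))) (cong₂ _+_ (∑-δ′ y₀) (∑-δ′ (- y₀))))
    where
    y₀≉0 : ¬ (y₀ ≈ 0ℤ)
    y₀≉0 y₀≈0 = D≉0 (≈-trans (≈-sym y₀²≈D) (*-cong y₀≈0 y₀≈0))
  ... | _ | nonsquare D≉0 ¬□ = trans (∑-cong (λ y → δ-≉ (¬□ y))) (sumOver-zero (upTo p))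

  ∑χ≡0 : ∑ χ ≡ 0ℤ
  ∑χ≡0 = begin
    ∑ χ                                    ≡⟨ eq (∑ (λ _ → 1ℤ)) (∑ χ) ⟩
    ∑ (λ _ → 1ℤ) + ∑ χ - ∑ (λ _ → 1ℤ)      ≡⟨ cong (_- ∑ (λ _ → 1ℤ)) (sym (∑-+ (λ _ → 1ℤ) χ)) ⟩
    ∑ (λ D → 1ℤ + χ D) - ∑ (λ _ → 1ℤ)      ≡⟨ cong (_- ∑ (λ _ → 1ℤ)) count-squares ⟩
    ∑ (λ _ → 1ℤ) - ∑ (λ _ → 1ℤ)            ≡⟨ ℤ.+-inverseʳ (∑ (λ _ → 1ℤ)) ⟩
    0ℤ                                     ∎
    where
    open ≡-Reasoning
    eq : ∀ s x → x ≡ s + x - s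
    eq = solve-∀
    count-squares : ∑ (λ D → 1ℤ + χ D) ≡ ∑ (λ _ → 1ℤ)
    count-squares = trans (∑-cong (sym ∘ ∑-δ-square))
                          (trans (∑-comm (λ D y → δ (y * y) D)) (∑-cong (λ y → ∑-δ (y * y))))

  χ≤1 : ∀ a → χ a ℤ.≤ 1ℤ
  χ≤1 a with χ a | legendreView a
  ... | _ | zero _        = ℤ.+≤+ ℕ.z≤n
  ... | _ | square _ _ _  = ℤ.≤-refl
  ... | _ | nonsquare _ _ = ℤ.-≤+

  χ-*-nonsquare : ∀ {a} → ¬ (a ≈ 0ℤ) → (∀ y → ¬ (y * y ≈ a)) → ∀ b → χ (a * b) ≡ - χ b
  -- T t = χ(at) + χ(t) is never positive and sums to 0, hence vanishes everywhere.
  χ-*-nonsquare {a} a≉0 ¬□ b = begin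
    χ (a * b)              ≡⟨ eq (χ (a * b)) (χ b) ⟩
    T b - χ b              ≡⟨ cong (_- χ b) (trans (T-cong (≈-sym (%ℕ-≈ b))) T[b%p]≡0) ⟩
    0ℤ - χ b               ≡⟨ ℤ.+-identityˡ (- χ b) ⟩
    - χ b                  ∎
    where
    open ≡-Reasoning
    eq : ∀ x y → x ≡ (x + y) - y
    eq = solve-∀
    T : ℤ → ℤ
    T t = χ (a * t) + χ t
    T-cong : T Preserves _≈_ ⟶ _≡_
    T-cong s≈t = cong₂ _+_ (χ-cong (*-cong (≈-refl {a}) s≈t)) (χ-cong s≈t)
    T≤0 : ∀ t → χ (a * t) + χ t ℤ.≤ 0ℤ
    T≤0 t with χ t | legendreView t
    ... | _ | zero t≈0 = ℤ.≤-reflexive (cong (_+ 0ℤ) (χ-≈0 (≈-trans (*-cong (≈-refl {a}) t≈0) (≈-reflexive (ℤ.*-zeroʳ a)))))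
    ... | _ | square t≉0 y y²≈t = ℤ.≤-reflexive (cong (_+ 1ℤ) (begin
      χ (a * t)            ≡⟨ χ-cong (≈-trans (*-cong (≈-refl {a}) (≈-sym y²≈t)) (≈-reflexive (ℤ.*-comm a (y * y)))) ⟩
      χ (y * y * a)        ≡⟨ χ-*-square y a (λ y≈0 → t≉0 (≈-trans (≈-sym y²≈t) (*-cong y≈0 y≈0))) ⟩
      χ a                  ≡⟨ χ-nonsquare a≉0 ¬□ ⟩
      -1ℤ                  ∎))
    ... | _ | nonsquare _ _ = ℤ.+-monoˡ-≤ -1ℤ (χ≤1 (a * t))
    ∑T≡0 : ∑ T ≡ 0ℤ
    ∑T≡0 = trans (∑-+ (λ t → χ (a * t)) χ) (cong₂ _+_ (trans (∑-scale a χ-cong a≉0) ∑χ≡0) ∑χ≡0)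
    T[b%p]≡0 : T (+ (b %ℕ p)) ≡ 0ℤ
    T[b%p]≡0 = sumOver-nonpos-≡0 (T≤0 ∘ +_) ∑T≡0 (∈-upTo⁺ (n%ℕd<d b p))

  χ-* : ∀ a b → χ (a * b) ≡ χ a * χ b
  χ-* a b with χ a | legendreView a
  ... | _ | zero a≈0 = χ-≈0 (≈-trans (*-cong a≈0 (≈-refl {b})) (≈-reflexive (ℤ.*-zeroˡ b)))
  ... | _ | square a≉0 y y²≈a = begin
    χ (a * b)        ≡⟨ χ-cong (*-cong (≈-sym y²≈a) (≈-refl {b})) ⟩
    χ (y * y * b)    ≡⟨ χ-*-square y b (λ y≈0 → a≉0 (≈-trans (≈-sym y²≈a) (*-cong y≈0 y≈0))) ⟩
    χ b              ≡⟨ ℤ.*-identityˡ (χ b) ⟨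
    1ℤ * χ b         ∎
    where open ≡-Reasoning
  ... | _ | nonsquare a≉0 ¬□ = trans (χ-*-nonsquare a≉0 ¬□ b) (sym (ℤ.-1*i≡-i (χ b)))

  ∑-δ-quadratic : ∀ t b → ∑ (λ x → δ (x * x - t * x + b) 0ℤ) ≡ 1ℤ + χ (t * t - + 4 * b)
  ∑-δ-quadratic t b = begin
    ∑ (λ x → δ (x * x - t * x + b) 0ℤ)   ≡⟨ ∑-cong (λ x → δ-⇔ (to x) (from x)) ⟩
    ∑ (λ x → G (+ 2 * x + - t))           ≡⟨ ∑-affine (+ 2) (- t) (λ y≈z → δ-congˡ Δ (*-cong y≈z y≈z)) 2≉0 ⟩
    ∑ G                                   ≡⟨ ∑-δ-square Δ ⟩
    1ℤ + χ Δ                              ∎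
    where
    open ≡-Reasoning
    Δ = t * t - + 4 * b
    G : ℤ → ℤ
    G y = δ (y * y) Δ
    completing-the-square : ∀ x t b →
      (+ 2 * x + - t) * (+ 2 * x + - t) - (t * t - + 4 * b) ≡ + 4 * ((x * x - t * x + b) - 0ℤ)
    completing-the-square = solve-∀
    to : ∀ x → x * x - t * x + b ≈ 0ℤ → (+ 2 * x + - t) * (+ 2 * x + - t) ≈ Δ
    to x = ≈-by (+ 4) (completing-the-square x t b)
    from : ∀ x → (+ 2 * x + - t) * (+ 2 * x + - t) ≈ Δ → x * x - t * x + b ≈ 0ℤ
    from x = *-cancelˡ-≈0 4≉0 ∘ ≈-by 1ℤ (completing-the-square′ x t b)
      where
      completing-the-square′ : ∀ x t b →
        + 4 * (x * x - t * x + b) - 0ℤ ≡ 1ℤ * ((+ 2 * x + - t) * (+ 2 * x + - t) - (t * t - + 4 * b))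
      completing-the-square′ = solve-∀

  ∑χ-2-isogeny : ∀ a b → ¬ (b ≈ 0ℤ) →
    ∑ (λ x → χ (x * (x * x + a * x + b))) ≡ ∑ (λ s → χ (s * (s * s - + 2 * a * s + (a * a - + 4 * b))))
  -- For x ≢ 0, x(x² + ax + b) = x²(φ x + a) with φ x = x + b/x, and φ x ≡ t iff x² - tx + b ≡ 0.
  ∑χ-2-isogeny a b b≉0 = begin
    ∑ (λ x → χ (x * (x * x + a * x + b)))              ≡⟨ ∑-cong cubic≡ ⟩
    ∑ (λ x → w x * F (φ x))                            ≡⟨ ∑-fibres w φ F F-cong ⟩
    ∑ (λ t → ∑ (λ x → w x * δ (φ x) t) * F t)          ≡⟨ ∑-cong (λ t → cong (_* F t) (fibre t)) ⟩
    ∑ (λ t → (1ℤ + χ (Δ t)) * F t)                     ≡⟨ ∑-cong (λ t → trans (ℤ.*-distribʳ-+ (F t) 1ℤ (χ (Δ t)))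
                                                            (cong₂ _+_ (ℤ.*-identityˡ (F t)) (sym (χ-* (Δ t) (t + a))))) ⟩
    ∑ (λ t → F t + G t)                                ≡⟨ ∑-+ F G ⟩
    ∑ F + ∑ G                                          ≡⟨ cong₂ _+_ (trans (∑-translate a χ-cong) ∑χ≡0)
                                                                    (sym (∑-translate (- a) G-cong)) ⟩
    0ℤ + ∑ (λ s → G (s + - a))                         ≡⟨ ℤ.+-identityˡ _ ⟩
    ∑ (λ s → G (s + - a))                              ≡⟨ ∑-cong (λ s → cong χ (shift s a b)) ⟩
    ∑ (λ s → χ (s * (s * s - + 2 * a * s + (a * a - + 4 * b)))) ∎
    where
    open ≡-Reasoning
    w φ F Δ G : ℤ → ℤ
    w x = 1ℤ - δ x 0ℤ
    φ x = x + b * x ⁻¹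
    F u = χ (u + a)
    Δ t = t * t - + 4 * b
    G t = χ (Δ t * (t + a))
    F-cong : F Preserves _≈_ ⟶ _≡_
    F-cong u≈v = χ-cong (+-cong u≈v (≈-refl {a}))
    G-cong : G Preserves _≈_ ⟶ _≡_
    G-cong s≈t = χ-cong (*-cong (-‿cong (*-cong s≈t s≈t) (≈-refl {+ 4 * b})) (+-cong s≈t (≈-refl {a})))
    shift : ∀ s a b → ((s + - a) * (s + - a) - + 4 * b) * (s + - a + a) ≡ s * (s * s - + 2 * a * s + (a * a - + 4 * b))
    shift = solve-∀
    cubic≡ : ∀ x → χ (x * (x * x + a * x + b)) ≡ w x * F (φ x)
    cubic≡ x with x ≈? 0ℤ
    ... | yes x≈0 = χ-≈0 (*-cong x≈0 (≈-refl {x * x + a * x + b}))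
    ... | no  x≉0 = begin
      χ (x * (x * x + a * x + b))     ≡⟨ χ-cong (≈-sym x²[φx+a]≈cubic) ⟩
      χ (x * x * (φ x + a))           ≡⟨ χ-*-square x (φ x + a) x≉0 ⟩
      F (φ x)                         ≡⟨ ℤ.*-identityˡ (F (φ x)) ⟨
      1ℤ * F (φ x)                    ∎
      where
      x²[φx+a]≈cubic : x * x * (φ x + a) ≈ x * (x * x + a * x + b)
      x²[φx+a]≈cubic = ≈-by (x * b) (eq x a b (x ⁻¹)) (⁻¹-inverseʳ x≉0)
        where
        eq : ∀ x a b i → x * x * (x + b * i + a) - x * (x * x + a * x + b) ≡ x * b * (x * i - 1ℤ)
        eq = solve-∀
    fibre : ∀ t → ∑ (λ x → w x * δ (φ x) t) ≡ 1ℤ + χ (Δ t)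
    fibre t = trans (∑-cong point) (∑-δ-quadratic t b)
      where
      point : ∀ x → w x * δ (φ x) t ≡ δ (x * x - t * x + b) 0ℤ
      point x with x ≈? 0ℤ
      ... | yes x≈0 = sym (δ-≉ (b≉0 ∘ ≈-trans b≈q))
        where
        b≈q : b ≈ x * x - t * x + b
        b≈q = ≈-by (- (x - t)) (eq x t b) x≈0
          where
          eq : ∀ x t b → b - (x * x - t * x + b) ≡ - (x - t) * (x - 0ℤ)
          eq = solve-∀
      ... | no x≉0 = trans (ℤ.*-identityˡ (δ (φ x) t)) (δ-⇔ to from)
        where
        x[φx-t]≈q : x * (φ x - t) ≈ x * x - t * x + b
        x[φx-t]≈q = ≈-by b (eq x t b (x ⁻¹)) (⁻¹-inverseʳ x≉0)
          where
          eq : ∀ x t b i → x * (x + b * i - t) - (x * x - t * x + b) ≡ b * (x * i - 1ℤ)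
          eq = solve-∀
        to : φ x ≈ t → x * x - t * x + b ≈ 0ℤ
        to φx≈t = ≈-trans (≈-sym x[φx-t]≈q) (≈-by x (eq x (φ x) t) φx≈t)
          where
          eq : ∀ x u t → x * (u - t) - 0ℤ ≡ x * (u - t)
          eq = solve-∀
        from : x * x - t * x + b ≈ 0ℤ → φ x ≈ t
        from q≈0 = -≈0⇒≈ (*-cancelˡ-≈0 x≉0 (≈-trans x[φx-t]≈q q≈0))

module PointCount (p : ℕ) .{{_ : NonZero p}} (p-prime : Prime p) (p>2 : 2 < p) where

  open PrimeField p p-prime
  open ResidueSums p
  open Legendre p p-prime p>2

  affine-points : ∀ (h : ℤ → ℤ) →
    + length (filter (λ xy → (+ (proj₂ xy ℕ.* proj₂ xy)) %ℕ p ℕ.≟ h (+ proj₁ xy) %ℕ p)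
                     (cartesianProduct (upTo p) (upTo p)))
    ≡ + p + ∑ (χ ∘ h)
  affine-points h = begin
    + length (filter on-curve? (cartesianProduct (upTo p) (upTo p)))
      ≡⟨ length-filter on-curve? (cartesianProduct (upTo p) (upTo p)) ⟩
    sumOver (cartesianProduct (upTo p) (upTo p)) (indicator ∘ on-curve?)
      ≡⟨ sumOver-cartesianProduct (upTo p) (upTo p) (indicator ∘ on-curve?) ⟩
    sumOver (upTo p) (λ x → sumOver (upTo p) (λ y → indicator (on-curve? (x , y))))
      ≡⟨ sumOver-cong (upTo p) (λ x → sumOver-cong (upTo p) (λ y →
           indicator-⇔ (to {x} {y}) (from {x} {y}) (on-curve? (x , y)) (+ y * + y ≈? h (+ x)))) ⟩
    ∑ (λ x → ∑ (λ y → δ (y * y) (h x)))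
      ≡⟨ ∑-cong (λ x → ∑-δ-square (h x)) ⟩
    ∑ (λ x → 1ℤ + χ (h x))
      ≡⟨ ∑-+ (λ _ → 1ℤ) (χ ∘ h) ⟩
    ∑ (λ _ → 1ℤ) + ∑ (χ ∘ h)
      ≡⟨ cong (_+ ∑ (χ ∘ h)) ∑-one ⟩
    + p + ∑ (χ ∘ h)   ∎
    where
    open ≡-Reasoning
    on-curve? = λ (xy : ℕ × ℕ) → (+ (proj₂ xy ℕ.* proj₂ xy)) %ℕ p ℕ.≟ h (+ proj₁ xy) %ℕ p
    to : ∀ {x y} → (+ (y ℕ.* y)) %ℕ p ≡ h (+ x) %ℕ p → + y * + y ≈ h (+ x)
    to {x} {y} eq = ≈-trans (≈-reflexive (sym (ℤ.pos-* y y))) (%ℕ≡⇒≈ eq)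
    from : ∀ {x y} → + y * + y ≈ h (+ x) → (+ (y ℕ.* y)) %ℕ p ≡ h (+ x) %ℕ p
    from {x} {y} y²≈hx = ≈⇒%ℕ≡ (≈-trans (≈-reflexive (ℤ.pos-* y y)) y²≈hx)

  aₚ≡-∑χ : ∀ k → aₚ p k ≡ - ∑ (χ ∘ g (+ k))
  aₚ≡-∑χ k = begin
    + (p ℕ.+ 1) - + ℕ.suc N               ≡⟨ cong₂ _-_ (ℤ.pos-+ p 1) (ℤ.pos-+ 1 N) ⟩
    (+ p + 1ℤ) - (1ℤ + + N)               ≡⟨ cong (λ n → (+ p + 1ℤ) - (1ℤ + n)) (affine-points (g (+ k))) ⟩
    (+ p + 1ℤ) - (1ℤ + (+ p + S))         ≡⟨ eq (+ p) S ⟩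
    - S                                   ∎
    where
    open ≡-Reasoning
    N = length (filter (λ xy → (+ (proj₂ xy ℕ.* proj₂ xy)) %ℕ p ℕ.≟ g (+ k) (+ proj₁ xy) %ℕ p)
                       (cartesianProduct (upTo p) (upTo p)))
    S = ∑ (χ ∘ g (+ k))
    eq : ∀ P S → (P + 1ℤ) - (1ℤ + (P + S)) ≡ - S
    eq = solve-∀

module EpsilonReduction (p : ℕ) .{{_ : NonZero p}} (p-prime : Prime p) (p>2 : 2 < p) where

  open PrimeField p p-prime
  open ResidueSums p
  open AffineSums p p-prime
  open Legendre p p-prime p>2

  -- The reciprocal polynomial u² f_j(1/u).
  f-rev : ℤ → ℤ → ℤ
  f-rev j u = 1ℤ - + 2 * (j + 1ℤ) * u + (j - 1ℤ) * (j - 1ℤ) * (u * u)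

  f-cong : ∀ j → f j Preserves _≈_ ⟶ _≈_
  f-cong j x≈y = +-cong (-‿cong (*-cong x≈y x≈y) (*-cong (≈-refl {+ 2 * (j + 1ℤ)}) x≈y)) (≈-refl {(j - 1ℤ) * (j - 1ℤ)})

  f-rev-cong : ∀ j → f-rev j Preserves _≈_ ⟶ _≈_
  f-rev-cong j u≈v =
    +-cong (-‿cong (≈-refl {1ℤ}) (*-cong (≈-refl {+ 2 * (j + 1ℤ)}) u≈v)) (*-cong (≈-refl {(j - 1ℤ) * (j - 1ℤ)}) (*-cong u≈v u≈v))

  u²f[u⁻¹]≈f-rev[u] : ∀ j {u} → ¬ (u ≈ 0ℤ) → u * u * f j (u ⁻¹) ≈ f-rev j u
  u²f[u⁻¹]≈f-rev[u] j {u} u≉0 = ≈-by (u * u ⁻¹ + 1ℤ - + 2 * (j + 1ℤ) * u) (eq u (u ⁻¹) j) (⁻¹-inverseʳ u≉0)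
    where
    eq : ∀ u v j → u * u * (v * v - + 2 * (j + 1ℤ) * v + (j - 1ℤ) * (j - 1ℤ))
                   - (1ℤ - + 2 * (j + 1ℤ) * u + (j - 1ℤ) * (j - 1ℤ) * (u * u))
                 ≡ (u * v + 1ℤ - + 2 * (j + 1ℤ) * u) * (u * v - 1ℤ)
    eq = solve-∀

  ε-inversion : ∀ k → ε p k ≡ ∑ (λ u → χ (f-rev 1ℤ u * f-rev (+ k) u)) - 1ℤ
  ε-inversion k = begin
    ∑ (λ x → χ (f 1ℤ x * f K x))             ≡⟨ ∑-reindex _⁻¹ _⁻¹ h-cong to from ⟨
    ∑ (λ u → χ (f 1ℤ (u ⁻¹) * f K (u ⁻¹)))   ≡⟨ ∑-cong inverted ⟩
    ∑ (λ u → χ (c u) - δ u 0ℤ)               ≡⟨ ∑-+ (χ ∘ c) (λ u → - δ u 0ℤ) ⟩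
    ∑ (χ ∘ c) + ∑ (λ u → - δ u 0ℤ)           ≡⟨ cong (_+_ (∑ (χ ∘ c)))
                                                     (trans (∑-neg (λ u → δ u 0ℤ)) (cong -_ (∑-δ′ 0ℤ))) ⟩
    ∑ (χ ∘ c) - 1ℤ                           ∎
    where
    open ≡-Reasoning
    K = + k
    c : ℤ → ℤ
    c u = f-rev 1ℤ u * f-rev K u
    h-cong : (λ x → χ (f 1ℤ x * f K x)) Preserves _≈_ ⟶ _≡_
    h-cong x≈y = χ-cong (*-cong (f-cong 1ℤ x≈y) (f-cong K x≈y))
    to : ∀ {u t} → u ⁻¹ ≈ t → u ≈ t ⁻¹
    to {u} u⁻¹≈t = ≈-trans (≈-sym (⁻¹-involutive u)) (⁻¹-cong u⁻¹≈t)
    from : ∀ {u t} → u ≈ t ⁻¹ → u ⁻¹ ≈ t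
    from {t = t} u≈t⁻¹ = ≈-trans (⁻¹-cong u≈t⁻¹) (⁻¹-involutive t)
    inverted : ∀ u → χ (f 1ℤ (u ⁻¹) * f K (u ⁻¹)) ≡ χ (c u) - δ u 0ℤ
    inverted u with u ≈? 0ℤ
    ... | yes u≈0 = begin
      χ (f 1ℤ (u ⁻¹) * f K (u ⁻¹))   ≡⟨ χ-≈0 (*-cong (f-cong 1ℤ (≈-reflexive (⁻¹-zero u≈0))) (≈-refl {f K (u ⁻¹)})) ⟩
      0ℤ                             ≡⟨ ℤ.+-inverseʳ 1ℤ ⟨
      1ℤ - 1ℤ                        ≡⟨ cong (_- 1ℤ) (trans (χ-cong c≈1) (χ-square 1≉0 1ℤ ≈-refl)) ⟨
      χ (c u) - 1ℤ                   ∎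
      where
      c≈1 : c u ≈ 1ℤ
      c≈1 = ≈-trans (*-cong (f-rev-cong 1ℤ u≈0) (f-rev-cong K u≈0)) (≈-reflexive (eq K))
        where
        eq : ∀ K → f-rev 1ℤ 0ℤ * (1ℤ - + 2 * (K + 1ℤ) * 0ℤ + (K - 1ℤ) * (K - 1ℤ) * (0ℤ * 0ℤ)) ≡ 1ℤ
        eq = solve-∀
    ... | no u≉0 = begin
      χ (f 1ℤ (u ⁻¹) * f K (u ⁻¹))                     ≡⟨ χ-*-square u _ u≉0 ⟨
      χ (u * u * (f 1ℤ (u ⁻¹) * f K (u ⁻¹)))           ≡⟨ χ-*-square u _ u≉0 ⟨
      χ (u * u * (u * u * (f 1ℤ (u ⁻¹) * f K (u ⁻¹)))) ≡⟨ χ-cong (≈-trans (≈-reflexive (eq u (f 1ℤ (u ⁻¹)) (f K (u ⁻¹))))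
                                                            (*-cong (u²f[u⁻¹]≈f-rev[u] 1ℤ u≉0) (u²f[u⁻¹]≈f-rev[u] K u≉0))) ⟩
      χ (c u)                                          ≡⟨ ℤ.+-identityʳ (χ (c u)) ⟨
      χ (c u) - 0ℤ                                     ∎
      where
      eq : ∀ u a b → u * u * (u * u * (a * b)) ≡ u * u * a * (u * u * b)
      eq = solve-∀

  m B C : ℤ → ℤ
  m K = (K - 1ℤ) * (K - 1ℤ)
  B K = - (+ 2 * (K * K - + 6 * K - + 3))
  C K = (K - 1ℤ) * (K - + 9)

  reversed-rescaled : ∀ K → ¬ (+ 4 * m K ≈ 0ℤ) → ∀ z →
    let u = (- (+ 4 * m K) ⁻¹) * z + (+ 4 * m K) ⁻¹ * m K in
    + 4 * m K * (+ 4 * m K) * (f-rev 1ℤ u * f-rev K u) ≈ z * (z * z + B K * z + C K * m K)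
  reversed-rescaled K 4m≉0 z = begin
    4m * 4m * (f-rev 1ℤ u * f-rev K u)   ≡⟨ clear-denominators K (m K) u ⟩
    P (4m * u)                           ≈⟨ P-cong 4mu≈m-z ⟩
    P (m K - z)                          ≡⟨ complete-cubic K z ⟩
    z * (z * z + B K * z + C K * m K)    ∎
    where
    open ≈-Reasoning
    4m = + 4 * m K
    u = (- 4m ⁻¹) * z + 4m ⁻¹ * m K
    P : ℤ → ℤ
    P Y = (m K - Y) * (+ 16 * m K - + 8 * (K + 1ℤ) * Y + Y * Y)
    P-cong : P Preserves _≈_ ⟶ _≈_
    P-cong Y≈Y′ = *-cong (-‿cong (≈-refl {m K}) Y≈Y′)
      (+-cong (-‿cong (≈-refl {+ 16 * m K}) (*-cong (≈-refl {+ 8 * (K + 1ℤ)}) Y≈Y′)) (*-cong Y≈Y′ Y≈Y′))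
    4mu≈m-z : 4m * u ≈ m K - z
    4mu≈m-z = ≈-by (m K - z) (eq (m K) (4m ⁻¹) z) (⁻¹-inverseʳ 4m≉0)
      where
      eq : ∀ m i z → + 4 * m * ((- i) * z + i * m) - (m - z) ≡ (m - z) * (+ 4 * m * i - 1ℤ)
      eq = solve-∀
    clear-denominators : ∀ K m u →
      + 4 * m * (+ 4 * m) * ((1ℤ - + 2 * (1ℤ + 1ℤ) * u + (1ℤ - 1ℤ) * (1ℤ - 1ℤ) * (u * u))
                             * (1ℤ - + 2 * (K + 1ℤ) * u + m * (u * u)))
      ≡ (m - + 4 * m * u) * (+ 16 * m - + 8 * (K + 1ℤ) * (+ 4 * m * u) + + 4 * m * u * (+ 4 * m * u))
    clear-denominators = solve-∀
    complete-cubic : ∀ K z →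
      (((K - 1ℤ) * (K - 1ℤ)) - (((K - 1ℤ) * (K - 1ℤ)) - z))
      * (+ 16 * ((K - 1ℤ) * (K - 1ℤ)) - + 8 * (K + 1ℤ) * (((K - 1ℤ) * (K - 1ℤ)) - z)
         + (((K - 1ℤ) * (K - 1ℤ)) - z) * (((K - 1ℤ) * (K - 1ℤ)) - z))
      ≡ z * (z * z + (- (+ 2 * (K * K - + 6 * K - + 3))) * z + ((K - 1ℤ) * (K - + 9)) * ((K - 1ℤ) * (K - 1ℤ)))
    complete-cubic = solve-∀

  reversed-to-cubic : ∀ K → ¬ (K - 1ℤ ≈ 0ℤ) →
    ∑ (λ u → χ (f-rev 1ℤ u * f-rev K u)) ≡ ∑ (λ z → χ (z * (z * z + B K * z + C K * m K)))
  reversed-to-cubic K K-1≉0 = begin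
    ∑ (χ ∘ c)                                         ≡⟨ ∑-affine (- i) (i * m K) c-cong -i≉0 ⟨
    ∑ (λ z → χ (c ((- i) * z + i * m K)))             ≡⟨ ∑-cong (λ z → trans (sym (χ-*-square 4m _ 4m≉0))
                                                                             (χ-cong (reversed-rescaled K 4m≉0 z))) ⟩
    ∑ (λ z → χ (z * (z * z + B K * z + C K * m K)))   ∎
    where
    open ≡-Reasoning
    c : ℤ → ℤ
    c u = f-rev 1ℤ u * f-rev K u
    c-cong : (χ ∘ c) Preserves _≈_ ⟶ _≡_
    c-cong u≈v = χ-cong (*-cong (f-rev-cong 1ℤ u≈v) (f-rev-cong K u≈v))
    4m = + 4 * m K
    4m≉0 : ¬ (4m ≈ 0ℤ)
    4m≉0 = *-≉0 4≉0 (*-≉0 K-1≉0 K-1≉0)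
    i = 4m ⁻¹
    -i≉0 : ¬ (- i ≈ 0ℤ)
    -i≉0 -i≈0 = ⁻¹-≉0 4m≉0 (≈-by -1ℤ (eq i) -i≈0)
      where
      eq : ∀ i → i - 0ℤ ≡ -1ℤ * (- i - 0ℤ)
      eq = solve-∀

  cubic-to-g : ∀ K → ¬ (K ≈ 0ℤ) →
    ∑ (λ s → χ (s * (s * s - + 2 * B K * s + (B K * B K - + 4 * (C K * m K))))) ≡ ∑ (χ ∘ g K)
  cubic-to-g K K≉0 = begin
    ∑ J                               ≡⟨ ∑-scale (+ 16 * K) J-cong (*-≉0 (*-≉0 4≉0 4≉0) K≉0) ⟨
    ∑ (λ x → J (+ 16 * K * x))        ≡⟨ ∑-cong (λ x → trans (cong χ (scale K x)) (χ-*-square (+ 32 * K) (g K x) 32K≉0)) ⟩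
    ∑ (χ ∘ g K)                       ∎
    where
    open ≡-Reasoning
    J : ℤ → ℤ
    J s = χ (s * (s * s - + 2 * B K * s + (B K * B K - + 4 * (C K * m K))))
    J-cong : J Preserves _≈_ ⟶ _≡_
    J-cong s≈t = χ-cong (*-cong s≈t (+-cong (-‿cong (*-cong s≈t s≈t) (*-cong (≈-refl {+ 2 * B K}) s≈t))
                                            (≈-refl {B K * B K - + 4 * (C K * m K)})))
    32K≉0 : ¬ (+ 32 * K ≈ 0ℤ)
    32K≉0 = *-≉0 (*-≉0 2≉0 (*-≉0 4≉0 4≉0)) K≉0
    scale : ∀ K x →
      (+ 16 * K * x) * ((+ 16 * K * x) * (+ 16 * K * x)
                        - + 2 * (- (+ 2 * (K * K - + 6 * K - + 3))) * (+ 16 * K * x)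
                        + ((- (+ 2 * (K * K - + 6 * K - + 3))) * (- (+ 2 * (K * K - + 6 * K - + 3)))
                           - + 4 * (((K - 1ℤ) * (K - + 9)) * ((K - 1ℤ) * (K - 1ℤ)))))
      ≡ + 32 * K * (+ 32 * K) * (x * (+ 4 * K * x * x + (K * K - + 6 * K - + 3) * x + + 4))
    scale = solve-∀

lemma7 : (p : ℕ) .{{_ : NonZero p}} → Prime p → 5 ≤ p →
         (k : ℕ) → 1 ≤ k → k < p → k % p ≢ 1 % p → k % p ≢ 9 % p →
         ε p k ≡ -1ℤ - aₚ p k
lemma7 p p-prime 5≤p k 1≤k k<p k≢1 k≢9 = begin
  ε p k                                                       ≡⟨ ε-inversion k ⟩
  ∑ (λ u → χ (f-rev 1ℤ u * f-rev K u)) - 1ℤ                   ≡⟨ cong (_- 1ℤ) (reversed-to-cubic K K-1≉0) ⟩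
  ∑ (λ z → χ (z * (z * z + B K * z + C K * m K))) - 1ℤ        ≡⟨ cong (_- 1ℤ) (∑χ-2-isogeny (B K) (C K * m K) Cm≉0) ⟩
  ∑ (λ s → χ (s * (s * s - + 2 * B K * s + (B K * B K - + 4 * (C K * m K))))) - 1ℤ
                                                              ≡⟨ cong (_- 1ℤ) (cubic-to-g K K≉0) ⟩
  ∑ (χ ∘ g K) - 1ℤ                                            ≡⟨ eq (∑ (χ ∘ g K)) ⟩
  -1ℤ - - ∑ (χ ∘ g K)                                         ≡⟨ cong (_-_ -1ℤ) (aₚ≡-∑χ k) ⟨
  -1ℤ - aₚ p k                                                ∎
  where
  open ≡-Reasoning
  p>2 : 2 < p
  p>2 = ℕ.m+n≤o⇒n≤o 2 5≤p
  open PrimeField p p-prime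
  open ResidueSums p
  open Legendre p p-prime p>2
  open PointCount p p-prime p>2
  open EpsilonReduction p p-prime p>2
  K = + k
  K≉0 : ¬ (K ≈ 0ℤ)
  K≉0 = +-≉0 1≤k k<p
  K-1≉0 : ¬ (K - 1ℤ ≈ 0ℤ)
  K-1≉0 K-1≈0 = k≢1 (≈⇒%ℕ≡ (-≈0⇒≈ {K} {1ℤ} K-1≈0))
  K-9≉0 : ¬ (K - + 9 ≈ 0ℤ)
  K-9≉0 K-9≈0 = k≢9 (≈⇒%ℕ≡ (-≈0⇒≈ {K} {+ 9} K-9≈0))
  Cm≉0 : ¬ (C K * m K ≈ 0ℤ)
  Cm≉0 = *-≉0 (*-≉0 K-1≉0 K-9≉0) (*-≉0 K-1≉0 K-1≉0)
  eq : ∀ S → S - 1ℤ ≡ -1ℤ - - S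
  eq = solve-∀
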